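{- Let $M$ be a simple binary supersolvable matroid of rank $r$ with an $M$-partition $\mathcal P=P_1\uplus\dots\uplus P_r$. Then the S-graph $G_{\mathcal P}$ is chordal.
   Context: Matroids are finite on ground set $[n]$; simple means all circuits have at least three elements; binary means the symmetric difference of any two different circuits is a union of disjoint circuits. A pair of flats $F,F'$ is modular if $r(F)+r(F')=r(F\vee F')+r(F\wedge F')$; a flat is modular if it forms a modular pair with every flat. $M$ of rank $r$ is supersolvable if there is a maximal chain of modular flats $\emptyset=F_0\subsetneq F_1\subsetneq\dots\subsetneq F_r=[n]$ (an $M$-chain); the associated $M$-partition is $P_i=F_i\setminus F_{i-1}$, $i=1,\dots,r$. A line is a flat of rank 2; it is nontrivial if it has at least three elements. The S-graph $G_{\mathcal P}$ has vertex set $\{P_1,\dots,P_r\}$, and $\{P_i,P_j\}$ ($i\ne j$) is an edge iff some nontrivial line of $M$ meets both $P_i$ and $P_j$. A graph is chordal if every cycle of length at least four has a chord. -}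

module Defs where

open import Data.Nat using (ℕ; zero; suc; _+_; _≤_; _<_; _≟_)
open import Data.Fin using (Fin; toℕ; inject₁) renaming (suc to fsuc; zero to fzero)
open import Data.Fin.Subset using (Subset; ⊥; ⊤; ⁅_⁆; _∈_; _∉_; _⊆_; _⊂_; ∁; _∩_; _∪_; _─_; ⋃; ∣_∣; Nonempty; Empty; inside; outside)
open import Data.Vec using (tabulate)
open import Data.Bool using (if_then_else_)
open import Data.List using (List)
open import Data.List.Relation.Unary.All using (All)
open import Data.List.Relation.Unary.AllPairs using (AllPairs)
open import Data.Product using (Σ; _×_; ∃; ∃-syntax)
open import Data.Sum using (_⊎_)
open import Relation.Nullary using (¬_)
open import Relation.Nullary.Decidable using (⌊_⌋)
open import Relation.Binary.PropositionalEquality using (_≡_; _≢_)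

record Matroid (n : ℕ) : Set where
  field
    rk          : Subset n → ℕ
    rk-bounded  : ∀ X → rk X ≤ ∣ X ∣
    rk-mono     : ∀ X Y → X ⊆ Y → rk X ≤ rk Y
    rk-submod   : ∀ X Y → rk (X ∪ Y) + rk (X ∩ Y) ≤ rk X + rk Y

module _ {n : ℕ} (M : Matroid n) where
  open Matroid M

  rank : ℕ
  rank = rk ⊤

  Independent : Subset n → Set
  Independent X = rk X ≡ ∣ X ∣

  Circuit : Subset n → Set
  Circuit C = ¬ Independent C × (∀ Y → Y ⊂ C → Independent Y)

  Simple : Set
  Simple = ∀ C → Circuit C → 3 ≤ ∣ C ∣

  _△_ : Subset n → Subset n → Subset n
  X △ Y = (X ─ Y) ∪ (Y ─ X)

  Binary : Set
  Binary = ∀ C C' → Circuit C → Circuit C' → C ≢ C' →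
    Σ (List (Subset n)) λ Cs →
      All Circuit Cs × AllPairs (λ A B → Empty (A ∩ B)) Cs × ⋃ Cs ≡ C △ C'

  cl : Subset n → Subset n
  cl X = tabulate λ e → if ⌊ rk (X ∪ ⁅ e ⁆) ≟ rk X ⌋ then inside else outside

  Flat : Subset n → Set
  Flat F = ∀ e → e ∉ F → rk F < rk (F ∪ ⁅ e ⁆)

  _∨F_ : Subset n → Subset n → Subset n
  F ∨F G = cl (F ∪ G)

  _∧F_ : Subset n → Subset n → Subset n
  F ∧F G = F ∩ G

  ModularPair : Subset n → Subset n → Set
  ModularPair F G = rk F + rk G ≡ rk (F ∨F G) + rk (F ∧F G)

  ModularFlat : Subset n → Set
  ModularFlat F = Flat F × (∀ G → Flat G → ModularPair F G)

  record MChain : Set where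
    field
      F        : Fin (suc rank) → Subset n
      F-modular : ∀ i → ModularFlat (F i)
      F-bottom : F fzero ≡ ⊥
      F-top    : F (Data.Fin.fromℕ rank) ≡ ⊤
      F-strict : ∀ (i : Fin rank) → F (inject₁ i) ⊂ F (fsuc i)

  Supersolvable : Set
  Supersolvable = MChain

  -- the associated M-partition: P_{i+1} = F_{i+1} ∖ F_i, indexed by Fin rank
  partition : MChain → Fin rank → Subset n
  partition ch i = MChain.F ch (fsuc i) ─ MChain.F ch (inject₁ i)

  NontrivialLine : Subset n → Set
  NontrivialLine L = Flat L × rk L ≡ 2 × 3 ≤ ∣ L ∣

  SGraphAdj : ∀ {r} → (Fin r → Subset n) → Fin r → Fin r → Set
  SGraphAdj P i j = i ≢ j × ∃[ L ] (NontrivialLine L × Nonempty (L ∩ P i) × Nonempty (L ∩ P j))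

CycSucc : (k : ℕ) → Fin k → Fin k → Set
CycSucc k i j = suc (toℕ i) ≡ toℕ j ⊎ (suc (toℕ i) ≡ k × toℕ j ≡ 0)

record Cycle {r : ℕ} (Adj : Fin r → Fin r → Set) (k : ℕ) : Set where
  field
    v        : Fin k → Fin r
    v-inj    : ∀ i j → v i ≡ v j → i ≡ j
    v-adj    : ∀ i j → CycSucc k i j → Adj (v i) (v j)

HasChord : ∀ {r} {Adj : Fin r → Fin r → Set} {k} → Cycle Adj k → Set
HasChord {Adj = Adj} {k} c = ∃[ i ] ∃[ j ]
  (i ≢ j × ¬ CycSucc k i j × ¬ CycSucc k j i × Adj (Cycle.v c i) (Cycle.v c j))

Chordal : ∀ {r} → (Fin r → Fin r → Set) → Set
Chordal {r} Adj = ∀ k → 4 ≤ k → (c : Cycle Adj k) → HasChord c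

-- Order the blocks by index; it suffices that the lower neighbours of each block P_m are pairwise
-- adjacent, for then the two cycle neighbours of the highest vertex of a cycle span a chord.
-- Put H = F_m ⊂ T = F_(m+1): H is modular and T covers H.  A nontrivial line through x ∈ P_a (a < m)
-- and a point p of P_m meets H only in x, so its third point p′ lies in P_m as well; any two points of
-- P_m lie on a line with a third point in H.  In a simple binary matroid lines have three points and
-- triangles behave like sums over GF(2): for x = p + p′ ∈ P_a and y = q + q′ ∈ P_b with a < b < m
-- and p, p′, q, q′ distinct (a shared point is easier), c₁ = p + q, c₂ = p′ + q, c₃ = p + q′ and
-- c₄ = p′ + q′ are points of H with x = c₁ + c₂ = c₃ + c₄ and y = c₁ + c₃ = c₂ + c₄.  If c₁ or c₄ lies in F_(b+1), a triangle through x can be rerouted to meet P_b;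
-- otherwise the line through c₁ and c₄ lies in the span of F_(b+1) and c₁, so by modularity it meets
-- F_(b+1) in the point x + y, and {x, y, x + y} is a triangle meeting P_a and P_b.

module Submission where

open import Defs
open import Data.Nat using (ℕ; zero; suc; _+_; _≤_; _<_; _≤?_; _≟_; z≤n; s≤s)
open import Data.Nat.Properties
open import Data.Fin using (Fin; toℕ; inject₁; fromℕ<) renaming (zero to fzero; suc to fsuc)
import Data.Fin.Properties as Fin
open import Data.Fin.Induction using (<-weakInduction; <-weakInduction-startingFrom; >-weakInduction)
open import Data.Fin.Subset
open import Data.Fin.Subset.Properties
open import Data.Bool using (true; false; if_then_else_)
open import Data.Vec using ([]; _∷_)
import Data.Vec as Vec
open import Data.Vec.Properties using (lookup∘tabulate; []=⇒lookup; lookup⇒[]=)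
open import Data.List using (List; []; _∷_; length; map)
open import Data.List.Membership.Propositional using () renaming (_∈_ to _∈ₗ_)
open import Data.List.Relation.Unary.Any using (here; there)
open import Data.List.Relation.Unary.All using (All; []; _∷_; lookup)
open import Data.List.Relation.Unary.AllPairs using (AllPairs; []; _∷_)
open import Data.List.Relation.Binary.Permutation.Propositional using (_↭_; prep; swap; ↭-refl)
open import Data.List.Relation.Binary.Permutation.Propositional.Properties using (∈-resp-↭)
open import Data.Product using (∃-syntax; _×_; _,_; proj₁; proj₂)
open import Data.Sum using (_⊎_; inj₁; inj₂; [_,_]′) renaming (map to ⊎-map)
open import Relation.Nullary using (¬_; Dec; yes; no; contradiction)
open import Relation.Binary.PropositionalEquality
open import Relation.Binary.Definitions using (tri<; tri≈; tri>)
open import Relation.Nullary.Decidable using (⌊_⌋; _×-dec_; ¬?; decidable-stable)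
open import Function using (_∘_)

∣p∪q∣+∣p∩q∣≡∣p∣+∣q∣ : ∀ {n} (p q : Subset n) → ∣ p ∪ q ∣ + ∣ p ∩ q ∣ ≡ ∣ p ∣ + ∣ q ∣
∣p∪q∣+∣p∩q∣≡∣p∣+∣q∣ [] [] = refl
∣p∪q∣+∣p∩q∣≡∣p∣+∣q∣ (true ∷ p) (true ∷ q) =
  cong suc (trans (+-suc _ _) (trans (cong suc (∣p∪q∣+∣p∩q∣≡∣p∣+∣q∣ p q)) (sym (+-suc _ _))))
∣p∪q∣+∣p∩q∣≡∣p∣+∣q∣ (true ∷ p) (false ∷ q) = cong suc (∣p∪q∣+∣p∩q∣≡∣p∣+∣q∣ p q)
∣p∪q∣+∣p∩q∣≡∣p∣+∣q∣ (false ∷ p) (true ∷ q) = trans (cong suc (∣p∪q∣+∣p∩q∣≡∣p∣+∣q∣ p q)) (sym (+-suc _ _))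
∣p∪q∣+∣p∩q∣≡∣p∣+∣q∣ (false ∷ p) (false ∷ q) = ∣p∪q∣+∣p∩q∣≡∣p∣+∣q∣ p q

x∈p─q⁻ : ∀ {n} {x : Fin n} (p q : Subset n) → x ∈ p ─ q → x ∈ p × x ∉ q
x∈p─q⁻ p q x∈p─q = p─q⊆p p q x∈p─q , x∉q p q x∈p─q
  where
  x∉q : ∀ {n} {x : Fin n} (p q : Subset n) → x ∈ p ─ q → x ∉ q
  x∉q (_ ∷ p) (_ ∷ q) (Vec.there x∈p─q) (Vec.there x∈q) = x∉q p q x∈p─q x∈q
  x∉q (_ ∷ p) (inside ∷ q) () Vec.here

module _ {n : ℕ} where

  ∈∉⇒≢ : ∀ {x y} {p : Subset n} → x ∈ p → y ∉ p → x ≢ y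
  ∈∉⇒≢ {p = p} x∈p y∉p x≡y = y∉p (subst (_∈ p) x≡y x∈p)

  ⁅x⁆⊆p : ∀ {x} {p : Subset n} → x ∈ p → ⁅ x ⁆ ⊆ p
  ⁅x⁆⊆p {x} {p} x∈p h = subst (_∈ p) (sym (x∈⁅y⁆⇒x≡y x h)) x∈p

  ∪⊆ : ∀ {p q r : Subset n} → p ⊆ r → q ⊆ r → p ∪ q ⊆ r
  ∪⊆ {p} {q} p⊆r q⊆r h = [ p⊆r , q⊆r ]′ (x∈p∪q⁻ p q h)

  ∣p∪q∣≤∣p∣+∣q∣ : ∀ (p q : Subset n) → ∣ p ∪ q ∣ ≤ ∣ p ∣ + ∣ q ∣
  ∣p∪q∣≤∣p∣+∣q∣ p q = ≤-trans (m≤m+n _ _) (≤-reflexive (∣p∪q∣+∣p∩q∣≡∣p∣+∣q∣ p q))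

  ∣p∪q∣≡∣p∣+∣q∣ : ∀ (p q : Subset n) → Empty (p ∩ q) → ∣ p ∪ q ∣ ≡ ∣ p ∣ + ∣ q ∣
  ∣p∪q∣≡∣p∣+∣q∣ p q disjoint = begin
    ∣ p ∪ q ∣                 ≡⟨ +-identityʳ _ ⟨
    ∣ p ∪ q ∣ + 0             ≡⟨ cong (∣ p ∪ q ∣ +_) (∣⊥∣≡0 n) ⟨
    ∣ p ∪ q ∣ + ∣ ⊥ {n} ∣     ≡⟨ cong (λ s → ∣ p ∪ q ∣ + ∣ s ∣) (Empty-unique disjoint) ⟨
    ∣ p ∪ q ∣ + ∣ p ∩ q ∣     ≡⟨ ∣p∪q∣+∣p∩q∣≡∣p∣+∣q∣ p q ⟩
    ∣ p ∣ + ∣ q ∣             ∎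
    where open ≡-Reasoning

  ∣p∣≤∣p─q∣+∣q∣ : ∀ (p q : Subset n) → ∣ p ∣ ≤ ∣ p ─ q ∣ + ∣ q ∣
  ∣p∣≤∣p─q∣+∣q∣ p q = ≤-trans (p⊆q⇒∣p∣≤∣q∣ p⊆[p─q]∪q) (∣p∪q∣≤∣p∣+∣q∣ (p ─ q) q)
    where
    p⊆[p─q]∪q : p ⊆ (p ─ q) ∪ q
    p⊆[p─q]∪q {x} x∈p with x ∈? q
    ... | yes x∈q = x∈p∪q⁺ (inj₂ x∈q)
    ... | no x∉q = x∈p∪q⁺ (inj₁ (x∈p∧x∉q⇒x∈p─q x∈p x∉q))

  ∣p∣>0⇒Nonempty : ∀ (p : Subset n) → 1 ≤ ∣ p ∣ → Nonempty p
  ∣p∣>0⇒Nonempty p 1≤∣p∣ with nonempty? p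
  ... | yes ne = ne
  ... | no ¬ne with () ← ≤-trans (subst (λ s → 1 ≤ ∣ s ∣) (Empty-unique ¬ne) 1≤∣p∣) (≤-reflexive (∣⊥∣≡0 n))

  opaque
    fromList : List (Fin n) → Subset n
    fromList xs = ⋃ (map ⁅_⁆ xs)

    ∈fromList⁺ : ∀ {x xs} → x ∈ₗ xs → x ∈ fromList xs
    ∈fromList⁺ {x} (here refl) = x∈p∪q⁺ (inj₁ (x∈⁅x⁆ x))
    ∈fromList⁺ (there h) = x∈p∪q⁺ (inj₂ (∈fromList⁺ h))

    ∈fromList⁻ : ∀ {x xs} → x ∈ fromList xs → x ∈ₗ xs
    ∈fromList⁻ {xs = []} h = contradiction h ∉⊥
    ∈fromList⁻ {xs = y ∷ ys} h with x∈p∪q⁻ ⁅ y ⁆ (fromList ys) h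
    ... | inj₁ h′ = here (x∈⁅y⁆⇒x≡y y h′)
    ... | inj₂ h′ = there (∈fromList⁻ h′)

    ∣fromList∣≤length : ∀ xs → ∣ fromList xs ∣ ≤ length xs
    ∣fromList∣≤length [] = ≤-reflexive (∣⊥∣≡0 n)
    ∣fromList∣≤length (x ∷ xs) = begin
      ∣ ⁅ x ⁆ ∪ fromList xs ∣       ≤⟨ ∣p∪q∣≤∣p∣+∣q∣ ⁅ x ⁆ (fromList xs) ⟩
      ∣ ⁅ x ⁆ ∣ + ∣ fromList xs ∣    ≤⟨ +-mono-≤ (≤-reflexive (∣⁅x⁆∣≡1 x)) (∣fromList∣≤length xs) ⟩
      suc (length xs)               ∎
      where open ≤-Reasoning

    ∣fromList∣≡length : ∀ {xs} → AllPairs _≢_ xs → ∣ fromList xs ∣ ≡ length xs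
    ∣fromList∣≡length {[]} [] = ∣⊥∣≡0 n
    ∣fromList∣≡length {x ∷ xs} (x∉xs ∷ distinct) = begin
      ∣ ⁅ x ⁆ ∪ fromList xs ∣       ≡⟨ ∣p∪q∣≡∣p∣+∣q∣ ⁅ x ⁆ (fromList xs) disjoint ⟩
      ∣ ⁅ x ⁆ ∣ + ∣ fromList xs ∣    ≡⟨ cong₂ _+_ (∣⁅x⁆∣≡1 x) (∣fromList∣≡length distinct) ⟩
      suc (length xs)               ∎
      where
      open ≡-Reasoning
      disjoint : Empty (⁅ x ⁆ ∩ fromList xs)
      disjoint (y , y∈) with x∈p∩q⁻ ⁅ x ⁆ (fromList xs) y∈
      ... | y∈⁅x⁆ , y∈xs with refl ← x∈⁅y⁆⇒x≡y x y∈⁅x⁆ = lookup x∉xs (∈fromList⁻ y∈xs) refl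

  fromList⊆ : ∀ {xs X} → All (_∈ X) xs → fromList xs ⊆ X
  fromList⊆ all h = lookup all (∈fromList⁻ h)

  ∉fromList : ∀ {x xs} → All (x ≢_) xs → x ∉ fromList xs
  ∉fromList all h = lookup all (∈fromList⁻ h) refl

  fromList-resp-↭ : ∀ {xs ys} → xs ↭ ys → fromList xs ⊆ fromList ys
  fromList-resp-↭ xs↭ys = ∈fromList⁺ ∘ ∈-resp-↭ xs↭ys ∘ ∈fromList⁻

  ∈₁ : ∀ {x xs} → x ∈ fromList (x ∷ xs)
  ∈₁ = ∈fromList⁺ (here refl)

  ∈₂ : ∀ {x y xs} → y ∈ fromList (x ∷ y ∷ xs)
  ∈₂ = ∈fromList⁺ (there (here refl))

  ∈₃ : ∀ {x y z xs} → z ∈ fromList (x ∷ y ∷ z ∷ xs)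
  ∈₃ = ∈fromList⁺ (there (there (here refl)))

  ∈₄ : ∀ {x y z w xs} → w ∈ fromList (x ∷ y ∷ z ∷ w ∷ xs)
  ∈₄ = ∈fromList⁺ (there (there (there (here refl))))

  pair : Fin n → Fin n → Subset n
  pair a b = fromList (a ∷ b ∷ [])

  triple : Fin n → Fin n → Fin n → Subset n
  triple a b c = fromList (a ∷ b ∷ c ∷ [])

module RankFunction {n : ℕ} (M : Matroid n) where
  open Matroid M

  rk-⊆ : ∀ {X Y} → X ⊆ Y → rk X ≤ rk Y
  rk-⊆ {X} {Y} = rk-mono X Y

  rk-∪⁅⁆≤ : ∀ X e → rk (X ∪ ⁅ e ⁆) ≤ suc (rk X)
  rk-∪⁅⁆≤ X e = begin
    rk (X ∪ ⁅ e ⁆)                      ≤⟨ m≤m+n _ _ ⟩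
    rk (X ∪ ⁅ e ⁆) + rk (X ∩ ⁅ e ⁆)     ≤⟨ rk-submod X ⁅ e ⁆ ⟩
    rk X + rk ⁅ e ⁆                     ≤⟨ +-monoʳ-≤ (rk X) (rk-bounded ⁅ e ⁆) ⟩
    rk X + ∣ ⁅ e ⁆ ∣                    ≡⟨ cong (rk X +_) (∣⁅x⁆∣≡1 e) ⟩
    rk X + 1                            ≡⟨ +-comm (rk X) 1 ⟩
    suc (rk X)                          ∎
    where open ≤-Reasoning

  absorbed-⊆ : ∀ {X Y e} → X ⊆ Y → rk (X ∪ ⁅ e ⁆) ≤ rk X → rk (Y ∪ ⁅ e ⁆) ≤ rk Y
  absorbed-⊆ {X} {Y} {e} X⊆Y e-absorbed = +-cancelʳ-≤ (rk X) _ _ (begin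
    rk (Y ∪ ⁅ e ⁆) + rk X                            ≤⟨ +-mono-≤ (rk-⊆ Y∪e⊆) (rk-⊆ X⊆∩) ⟩
    rk (Y ∪ (X ∪ ⁅ e ⁆)) + rk (Y ∩ (X ∪ ⁅ e ⁆))      ≤⟨ rk-submod Y (X ∪ ⁅ e ⁆) ⟩
    rk Y + rk (X ∪ ⁅ e ⁆)                            ≤⟨ +-monoʳ-≤ (rk Y) e-absorbed ⟩
    rk Y + rk X                                      ∎)
    where
    open ≤-Reasoning
    Y∪e⊆ : Y ∪ ⁅ e ⁆ ⊆ Y ∪ (X ∪ ⁅ e ⁆)
    Y∪e⊆ h = [ p⊆p∪q _ , q⊆p∪q Y _ ∘ q⊆p∪q X _ ]′ (x∈p∪q⁻ Y ⁅ e ⁆ h)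
    X⊆∩ : X ⊆ Y ∩ (X ∪ ⁅ e ⁆)
    X⊆∩ h = x∈p∩q⁺ (X⊆Y h , p⊆p∪q _ h)

  absorbed⇒∈flat : ∀ {X Y e} → Flat M Y → X ⊆ Y → rk (X ∪ ⁅ e ⁆) ≤ rk X → e ∈ Y
  absorbed⇒∈flat {Y = Y} {e} Y-flat X⊆Y e-absorbed with e ∈? Y
  ... | yes e∈Y = e∈Y
  ... | no e∉Y = contradiction (absorbed-⊆ X⊆Y e-absorbed) (<⇒≱ (Y-flat e e∉Y))

  ∈cl⁺ : ∀ {X e} → rk (X ∪ ⁅ e ⁆) ≡ rk X → e ∈ cl M X
  ∈cl⁺ {X} {e} e-absorbed = lookup⇒[]= e (cl M X) (trans (lookup∘tabulate _ e) decided)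
    where
    decided : (if ⌊ rk (X ∪ ⁅ e ⁆) ≟ rk X ⌋ then inside else outside) ≡ inside
    decided with rk (X ∪ ⁅ e ⁆) ≟ rk X
    ... | yes _ = refl
    ... | no rk≢ = contradiction e-absorbed rk≢

  ∈cl⁻ : ∀ {X e} → e ∈ cl M X → rk (X ∪ ⁅ e ⁆) ≡ rk X
  ∈cl⁻ {X} {e} e∈ = decided (trans (sym (lookup∘tabulate _ e)) ([]=⇒lookup e∈))
    where
    decided : (if ⌊ rk (X ∪ ⁅ e ⁆) ≟ rk X ⌋ then inside else outside) ≡ inside → rk (X ∪ ⁅ e ⁆) ≡ rk X
    decided _ with rk (X ∪ ⁅ e ⁆) ≟ rk X
    decided _  | yes rk≡ = rk≡
    decided () | no _

  X⊆clX : ∀ {X} → X ⊆ cl M X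
  X⊆clX e∈X = ∈cl⁺ (≤-antisym (rk-⊆ (∪⊆ (λ h → h) (⁅x⁆⊆p e∈X))) (rk-⊆ (p⊆p∪q _)))

  rk-∪-absorbed : ∀ X A → (∀ {e} → e ∈ A → rk (X ∪ ⁅ e ⁆) ≤ rk X) → rk (X ∪ A) ≤ rk X
  rk-∪-absorbed X A = go ∣ A ∣ A ≤-refl
    where
    go : ∀ k A → ∣ A ∣ ≤ k → (∀ {e} → e ∈ A → rk (X ∪ ⁅ e ⁆) ≤ rk X) → rk (X ∪ A) ≤ rk X
    go k A _ absorbed with nonempty? A
    go k A _ absorbed | no A-empty = rk-⊆ (∪⊆ (λ h → h) (λ {x} x∈A → contradiction (x , x∈A) A-empty))
    go zero A ∣A∣≤ absorbed | yes (e , e∈A) = contradiction (≤-trans (x∈p⇒∣p-x∣<∣p∣ e∈A) ∣A∣≤) λ ()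
    go (suc k) A ∣A∣≤ absorbed | yes (e , e∈A) = begin
      rk (X ∪ A)                     ≤⟨ rk-⊆ X∪A⊆ ⟩
      rk ((X ∪ (A - e)) ∪ ⁅ e ⁆)     ≤⟨ absorbed-⊆ (p⊆p∪q (A - e)) (absorbed e∈A) ⟩
      rk (X ∪ (A - e))               ≤⟨ go k (A - e) ∣A-e∣≤k (absorbed ∘ p─q⊆p _ _) ⟩
      rk X                           ∎
      where
      open ≤-Reasoning
      ∣A-e∣≤k : ∣ A - e ∣ ≤ k
      ∣A-e∣≤k = ≤-pred (≤-trans (x∈p⇒∣p-x∣<∣p∣ e∈A) ∣A∣≤)
      X∪A⊆ : X ∪ A ⊆ (X ∪ (A - e)) ∪ ⁅ e ⁆
      X∪A⊆ = ∪⊆ (p⊆p∪q _ ∘ p⊆p∪q _) λ {x} x∈A → case x∈A (x Fin.≟ e)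
        where
        case : ∀ {x} → x ∈ A → Dec (x ≡ e) → x ∈ (X ∪ (A - e)) ∪ ⁅ e ⁆
        case _ (yes refl) = q⊆p∪q _ _ (x∈⁅x⁆ e)
        case x∈A (no x≢e) = p⊆p∪q _ (q⊆p∪q X _ (x∈p∧x≢y⇒x∈p-y x∈A x≢e))

  rk-cl : ∀ X → rk (cl M X) ≡ rk X
  rk-cl X = ≤-antisym
    (≤-trans (rk-⊆ (q⊆p∪q X (cl M X))) (rk-∪-absorbed X (cl M X) (≤-reflexive ∘ ∈cl⁻)))
    (rk-⊆ X⊆clX)

  cl-flat : ∀ X → Flat M (cl M X)
  cl-flat X e e∉ = ≰⇒> λ e-absorbed → e∉ (∈cl⁺ (≤-antisym (begin
    rk (X ∪ ⁅ e ⁆)          ≤⟨ rk-⊆ (∪⊆ (p⊆p∪q _ ∘ X⊆clX) (q⊆p∪q _ _)) ⟩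
    rk (cl M X ∪ ⁅ e ⁆)     ≤⟨ e-absorbed ⟩
    rk (cl M X)             ≡⟨ rk-cl X ⟩
    rk X                    ∎) (rk-⊆ (p⊆p∪q _))))
    where open ≤-Reasoning

  cl-least : ∀ {X Y} → Flat M Y → X ⊆ Y → cl M X ⊆ Y
  cl-least Y-flat X⊆Y e∈ = absorbed⇒∈flat Y-flat X⊆Y (≤-reflexive (∈cl⁻ e∈))

  rk-nonempty : ∀ X → 1 ≤ rk X → Nonempty X
  rk-nonempty X 1≤rk = ∣p∣>0⇒Nonempty X (≤-trans 1≤rk (rk-bounded X))

  modular : ∀ {H G} → ModularFlat M H → Flat M G → rk H + rk G ≡ rk (H ∪ G) + rk (H ∩ G)
  modular {H} {G} (_ , modular-pair) G-flat =
    trans (modular-pair G G-flat) (cong (_+ rk (H ∩ G)) (rk-cl (H ∪ G)))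

  modular-meets-line : ∀ {H L} → ModularFlat M H → Flat M L → rk L ≡ 2 →
                       rk (H ∪ L) ≤ suc (rk H) → Nonempty (H ∩ L)
  modular-meets-line {H} {L} H-mod L-flat rkL≡2 H∪L-small =
    rk-nonempty (H ∩ L) (+-cancelˡ-≤ (suc (rk H)) 1 _ (begin
    suc (rk H) + 1                   ≡⟨ +-suc (rk H) 1 ⟨
    rk H + 2                         ≡⟨ cong (rk H +_) rkL≡2 ⟨
    rk H + rk L                      ≡⟨ modular H-mod L-flat ⟩
    rk (H ∪ L) + rk (H ∩ L)          ≤⟨ +-monoˡ-≤ (rk (H ∩ L)) H∪L-small ⟩
    suc (rk H) + rk (H ∩ L)          ∎))
    where open ≤-Reasoning

  modular-line-trace≤1 : ∀ {H L p} → ModularFlat M H → Flat M L → rk L ≡ 2 →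
                         p ∈ L → p ∉ H → rk (H ∩ L) ≤ 1
  modular-line-trace≤1 {H} {L} {p} H-mod L-flat rkL≡2 p∈L p∉H = +-cancelˡ-≤ (suc (rk H)) _ 1 (begin
    suc (rk H) + rk (H ∩ L)          ≤⟨ +-monoˡ-≤ (rk (H ∩ L)) (<-≤-trans (proj₁ H-mod p p∉H) (rk-⊆ H∪p⊆H∪L)) ⟩
    rk (H ∪ L) + rk (H ∩ L)          ≡⟨ modular H-mod L-flat ⟨
    rk H + rk L                      ≡⟨ cong (rk H +_) rkL≡2 ⟩
    rk H + 2                         ≡⟨ +-suc (rk H) 1 ⟩
    suc (rk H) + 1                   ∎)
    where
    open ≤-Reasoning
    H∪p⊆H∪L : H ∪ ⁅ p ⁆ ⊆ H ∪ L
    H∪p⊆H∪L = ∪⊆ (p⊆p∪q L) (q⊆p∪q H L ∘ ⁅x⁆⊆p p∈L)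

  dependent⇒circuit : ∀ X → ¬ Independent M X → ∃[ C ] C ⊆ X × Circuit M C
  dependent⇒circuit X = go ∣ X ∣ X ≤-refl
    where
    go : ∀ k X → ∣ X ∣ ≤ k → ¬ Independent M X → ∃[ C ] C ⊆ X × Circuit M C
    go k X ∣X∣≤ dep with anySubset? (λ Y → (Y ⊂? X) ×-dec ¬? (rk Y ≟ ∣ Y ∣))
    go k X ∣X∣≤ dep | no no-smaller =
      X , (λ h → h) , dep , λ Y Y⊂X → decidable-stable (rk Y ≟ ∣ Y ∣) λ dep-Y → no-smaller (Y , Y⊂X , dep-Y)
    go zero X ∣X∣≤ dep | yes (Y , Y⊂X , _) = contradiction (≤-trans (p⊂q⇒∣p∣<∣q∣ Y⊂X) ∣X∣≤) λ ()
    go (suc k) X ∣X∣≤ dep | yes (Y , Y⊂X , dep-Y)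
      with C , C⊆Y , C-circuit ← go k Y (≤-pred (≤-trans (p⊂q⇒∣p∣<∣q∣ Y⊂X) ∣X∣≤)) dep-Y
      = C , p⊂q⇒p⊆q Y⊂X ∘ C⊆Y , C-circuit

module SimpleMatroid {n : ℕ} (M : Matroid n) (simple : Simple M) where
  open Matroid M
  open RankFunction M

  small⇒independent : ∀ X → ∣ X ∣ ≤ 2 → Independent M X
  small⇒independent X ∣X∣≤2 = decidable-stable (rk X ≟ ∣ X ∣) λ dep →
    let C , C⊆X , C-circuit = dependent⇒circuit X dep
    in contradiction (≤-trans (simple C C-circuit) (≤-trans (p⊆q⇒∣p∣≤∣q∣ C⊆X) ∣X∣≤2)) 1+n≰n

  rk-pair : ∀ {a b} → a ≢ b → rk (pair a b) ≡ 2
  rk-pair a≢b = trans (small⇒independent _ (∣fromList∣≤length _)) (∣fromList∣≡length ((a≢b ∷ []) ∷ [] ∷ []))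

  record Triangle (a b c : Fin n) : Set where
    field
      ≢₁₂  : a ≢ b
      ≢₁₃  : a ≢ c
      ≢₂₃  : b ≢ c
      rk≤2 : rk (triple a b c) ≤ 2

  open Triangle

  swap₁₂ : ∀ {a b c} → Triangle a b c → Triangle b a c
  swap₁₂ t = record { ≢₁₂ = ≢-sym (≢₁₂ t) ; ≢₁₃ = ≢₂₃ t ; ≢₂₃ = ≢₁₃ t
                    ; rk≤2 = ≤-trans (rk-⊆ (fromList-resp-↭ (swap _ _ ↭-refl))) (rk≤2 t) }

  swap₂₃ : ∀ {a b c} → Triangle a b c → Triangle a c b
  swap₂₃ t = record { ≢₁₂ = ≢₁₃ t ; ≢₁₃ = ≢₁₂ t ; ≢₂₃ = ≢-sym (≢₂₃ t)
                    ; rk≤2 = ≤-trans (rk-⊆ (fromList-resp-↭ (prep _ (swap _ _ ↭-refl)))) (rk≤2 t) }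

  rotate : ∀ {a b c} → Triangle a b c → Triangle b c a
  rotate = swap₂₃ ∘ swap₁₂

  triangle⇒circuit : ∀ {a b c} → Triangle a b c → Circuit M (triple a b c)
  triangle⇒circuit t =
    dependent , λ Y Y⊂ → small⇒independent Y (≤-pred (≤-trans (p⊂q⇒∣p∣<∣q∣ Y⊂) (∣fromList∣≤length _)))
    where
    dependent : ¬ Independent M (triple _ _ _)
    dependent independent = contradiction (≤-trans (≤-reflexive (sym (trans independent
      (∣fromList∣≡length ((≢₁₂ t ∷ ≢₁₃ t ∷ []) ∷ (≢₂₃ t ∷ []) ∷ [] ∷ []))))) (rk≤2 t)) 1+n≰n

  circuit⇒triangle : ∀ {a b c} → Circuit M (triple a b c) → Triangle a b c
  circuit⇒triangle {a} {b} {c} C = record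
    { ≢₁₂ = λ { refl → inside-pair (fromList⊆ (∈₁ ∷ ∈₁ ∷ ∈₂ ∷ [])) }
    ; ≢₁₃ = λ { refl → inside-pair (fromList⊆ (∈₁ ∷ ∈₂ ∷ ∈₁ ∷ [])) }
    ; ≢₂₃ = λ { refl → inside-pair (fromList⊆ (∈₁ ∷ ∈₂ ∷ ∈₂ ∷ [])) }
    ; rk≤2 = ≤-pred (≤-trans (≤∧≢⇒< (rk-bounded _) (proj₁ C)) (∣fromList∣≤length _))
    }
    where
    inside-pair : ∀ {u v} → ¬ triple a b c ⊆ pair u v
    inside-pair ⊆pair =
      contradiction (≤-trans (simple _ C) (≤-trans (p⊆q⇒∣p∣≤∣q∣ ⊆pair) (∣fromList∣≤length _))) 1+n≰n

  triangle-closed : ∀ {a b c Y} → Triangle a b c → Flat M Y → a ∈ Y → b ∈ Y → c ∈ Y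
  triangle-closed t Y-flat a∈Y b∈Y = absorbed⇒∈flat Y-flat (fromList⊆ (a∈Y ∷ b∈Y ∷ [])) (begin
    rk (pair _ _ ∪ ⁅ _ ⁆)    ≤⟨ rk-⊆ (∪⊆ (fromList⊆ (∈₁ ∷ ∈₂ ∷ [])) (⁅x⁆⊆p ∈₃)) ⟩
    rk (triple _ _ _)        ≤⟨ rk≤2 t ⟩
    2                        ≡⟨ rk-pair (≢₁₂ t) ⟨
    rk (pair _ _)            ∎)
    where open ≤-Reasoning

  TriangleBetween : Subset n → Subset n → Set
  TriangleBetween X Y = ∃[ u ] ∃[ v ] ∃[ w ] u ∈ X × v ∈ Y × Triangle u v w

  TriangleBetween-sym : ∀ {X Y} → TriangleBetween X Y → TriangleBetween Y X
  TriangleBetween-sym (u , v , w , u∈X , v∈Y , t) = v , u , w , v∈Y , u∈X , swap₁₂ t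

  triangle⇒line : ∀ {X Y} → TriangleBetween X Y →
                  ∃[ L ] NontrivialLine M L × Nonempty (L ∩ X) × Nonempty (L ∩ Y)
  triangle⇒line {X} {Y} (u , v , w , u∈X , v∈Y , t) =
    L , (cl-flat _ , trans (rk-cl _) (rk-pair (≢₁₂ t)) , three-points) ,
    (u , x∈p∩q⁺ (u∈L , u∈X)) , (v , x∈p∩q⁺ (v∈L , v∈Y))
    where
    L = cl M (pair u v)
    u∈L : u ∈ L
    u∈L = X⊆clX ∈₁
    v∈L : v ∈ L
    v∈L = X⊆clX ∈₂
    three-points : 3 ≤ ∣ L ∣
    three-points = ≤-trans (≤-reflexive (sym (∣fromList∣≡length ((≢₁₂ t ∷ ≢₁₃ t ∷ []) ∷ (≢₂₃ t ∷ []) ∷ [] ∷ []))))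
      (p⊆q⇒∣p∣≤∣q∣ (fromList⊆ (u∈L ∷ v∈L ∷ triangle-closed t (cl-flat _) u∈L v∈L ∷ [])))

  triangle-on-line : ∀ {a b c L} → a ≢ b → a ≢ c → b ≢ c → a ∈ L → b ∈ L → c ∈ L → rk L ≡ 2 → Triangle a b c
  triangle-on-line a≢b a≢c b≢c a∈L b∈L c∈L rkL≡2 = record
    { ≢₁₂ = a≢b ; ≢₁₃ = a≢c ; ≢₂₃ = b≢c
    ; rk≤2 = ≤-trans (rk-⊆ (fromList⊆ (a∈L ∷ b∈L ∷ c∈L ∷ []))) (≤-reflexive rkL≡2) }

  triangle-to-layer : ∀ {A B X x y c c′ c″ c‴} → Flat M A → Flat M B → x ∈ X → y ∈ B ─ A → c ∈ B →
                      Triangle x c c′ → Triangle y c c″ → Triangle x c″ c‴ → TriangleBetween X (B ─ A)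
  triangle-to-layer {A} {B} {c = c} {c′} {c″} {c‴} A-flat B-flat x∈X y∈B─A c∈B xcc′ ycc″ xc″c‴ with c ∈? A
  ... | no c∉A = _ , c , c′ , x∈X , x∈p∧x∉q⇒x∈p─q c∈B c∉A , xcc′
  ... | yes c∈A = _ , c″ , c‴ , x∈X , x∈p∧x∉q⇒x∈p─q c″∈B c″∉A , xc″c‴
    where
    y∈B = proj₁ (x∈p─q⁻ B A y∈B─A)
    y∉A = proj₂ (x∈p─q⁻ B A y∈B─A)
    c″∈B : c″ ∈ B
    c″∈B = triangle-closed ycc″ B-flat y∈B c∈B
    c″∉A : c″ ∉ A
    c″∉A c″∈A = y∉A (triangle-closed (rotate ycc″) A-flat c∈A c″∈A)

  line-third-point-outside : ∀ {H T L x p} → ModularFlat M H → Flat M T → H ⊆ T → NontrivialLine M L →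
              x ∈ L → x ∈ H → p ∈ L → p ∈ T ─ H → ∃[ p′ ] p′ ∈ T ─ H × Triangle x p p′
  line-third-point-outside {H} {T} {L} {x} {p} H-mod T-flat H⊆T (L-flat , rkL≡2 , 3≤∣L∣) x∈L x∈H p∈L p∈T─H =
    e , x∈p∧x∉q⇒x∈p─q e∈T e∉H , xpe
    where
    p∈T = proj₁ (x∈p─q⁻ T H p∈T─H)
    p∉H = proj₂ (x∈p─q⁻ T H p∈T─H)
    third : Nonempty (L ─ pair x p)
    third = ∣p∣>0⇒Nonempty (L ─ pair x p) (+-cancelʳ-≤ 2 1 _ (begin
      3                               ≤⟨ 3≤∣L∣ ⟩
      ∣ L ∣                           ≤⟨ ∣p∣≤∣p─q∣+∣q∣ L (pair x p) ⟩
      ∣ L ─ pair x p ∣ + ∣ pair x p ∣  ≤⟨ +-monoʳ-≤ _ (∣fromList∣≤length (x ∷ p ∷ [])) ⟩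
      ∣ L ─ pair x p ∣ + 2            ∎))
      where open ≤-Reasoning
    e = proj₁ third
    e∈L = proj₁ (x∈p─q⁻ L (pair x p) (proj₂ third))
    e∉xp = proj₂ (x∈p─q⁻ L (pair x p) (proj₂ third))
    x≢e : x ≢ e
    x≢e = ∈∉⇒≢ ∈₁ e∉xp
    xpe : Triangle x p e
    xpe = triangle-on-line (∈∉⇒≢ x∈H p∉H) x≢e (∈∉⇒≢ ∈₂ e∉xp) x∈L p∈L e∈L rkL≡2
    e∈T : e ∈ T
    e∈T = triangle-closed xpe T-flat (H⊆T x∈H) p∈T
    e∉H : e ∉ H
    e∉H e∈H = 1+n≰n (begin
      2                 ≡⟨ rk-pair x≢e ⟨
      rk (pair x e)     ≤⟨ rk-⊆ (fromList⊆ (x∈p∩q⁺ (x∈H , x∈L) ∷ x∈p∩q⁺ (e∈H , e∈L) ∷ [])) ⟩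
      rk (H ∩ L)        ≤⟨ modular-line-trace≤1 H-mod L-flat rkL≡2 p∈L p∉H ⟩
      1                 ∎)
      where open ≤-Reasoning

module BinaryMatroid {n : ℕ} (M : Matroid n) (simple : Simple M) (binary : Binary M) where
  open Matroid M
  open RankFunction M
  open SimpleMatroid M simple
  open Triangle

  ∈△⁻ : ∀ {C C′ x} → x ∈ _△_ M C C′ → (x ∈ C × x ∉ C′) ⊎ (x ∈ C′ × x ∉ C)
  ∈△⁻ {C} {C′} h = ⊎-map (x∈p─q⁻ C C′) (x∈p─q⁻ C′ C) (x∈p∪q⁻ (C ─ C′) (C′ ─ C) h)

  ∈△⁺ˡ : ∀ {C C′ x} → x ∈ C → x ∉ C′ → x ∈ _△_ M C C′
  ∈△⁺ˡ x∈C x∉C′ = x∈p∪q⁺ (inj₁ (x∈p∧x∉q⇒x∈p─q x∈C x∉C′))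

  ∈△⁺ʳ : ∀ {C C′ x} → x ∈ C′ → x ∉ C → x ∈ _△_ M C C′
  ∈△⁺ʳ x∈C′ x∉C = x∈p∪q⁺ (inj₂ (x∈p∧x∉q⇒x∈p─q x∈C′ x∉C))

  ∉△-self : ∀ {C x} → x ∉ _△_ M C C
  ∉△-self h = [ (λ (∈C , ∉C) → ∉C ∈C) , (λ (∈C , ∉C) → ∉C ∈C) ]′ (∈△⁻ h)

  -- In a simple matroid two disjoint circuits already have six elements.
  small-△⇒circuit : ∀ {C C′ D} → Circuit M C → Circuit M C′ → Nonempty D →
                    D ⊆ _△_ M C C′ → _△_ M C C′ ⊆ D → ∣ D ∣ ≤ 5 → Circuit M D
  small-△⇒circuit {C} {C′} {D} C-circuit C′-circuit (x , x∈D) D⊆△ △⊆D ∣D∣≤5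
    with Cs , Cs-circuits , Cs-disjoint , ⋃Cs≡△ ←
           binary C C′ C-circuit C′-circuit (λ { refl → ∉△-self (D⊆△ x∈D) })
    = decompose Cs Cs-circuits Cs-disjoint
        (⊆-antisym (λ h → subst (_ ∈_) (sym ⋃Cs≡△) (D⊆△ h)) (λ h → △⊆D (subst (_ ∈_) ⋃Cs≡△ h)))
    where
    decompose : ∀ Cs → All (Circuit M) Cs → AllPairs (λ A B → Empty (A ∩ B)) Cs → D ≡ ⋃ Cs → Circuit M D
    decompose [] _ _ refl = contradiction x∈D ∉⊥
    decompose (A ∷ []) (A-circuit ∷ []) _ refl = subst (Circuit M) (sym (∪-identityʳ A)) A-circuit
    decompose (A ∷ B ∷ Cs) (A-circuit ∷ B-circuit ∷ _) ((A∩B-empty ∷ _) ∷ _) refl =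
      contradiction (begin
        6                     ≤⟨ +-mono-≤ (simple A A-circuit) (simple B B-circuit) ⟩
        ∣ A ∣ + ∣ B ∣         ≡⟨ ∣p∪q∣≡∣p∣+∣q∣ A B A∩B-empty ⟨
        ∣ A ∪ B ∣             ≤⟨ p⊆q⇒∣p∣≤∣q∣ {q = A ∪ (B ∪ ⋃ Cs)} (∪⊆ (p⊆p∪q _) (q⊆p∪q A _ ∘ p⊆p∪q _)) ⟩
        ∣ D ∣                 ≤⟨ ∣D∣≤5 ⟩
        5                     ∎) 1+n≰n
      where open ≤-Reasoning

  third-point-unique : ∀ {a b s t} → Triangle a b s → Triangle a b t → s ≡ t
  third-point-unique {a} {b} {s} {t} abs abt = decidable-stable (s Fin.≟ t) two-thirds-absurd
    where
    two-thirds-absurd : ¬ s ≢ t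
    two-thirds-absurd s≢t = 1+n≰n (≤-trans (simple _ st-circuit) (∣fromList∣≤length (s ∷ t ∷ [])))
      where
      to : pair s t ⊆ _△_ M (triple a b s) (triple a b t)
      to h with ∈fromList⁻ h
      ... | here refl = ∈△⁺ˡ ∈₃ (∉fromList (≢-sym (≢₁₃ abs) ∷ ≢-sym (≢₂₃ abs) ∷ s≢t ∷ []))
      ... | there (here refl) = ∈△⁺ʳ ∈₃ (∉fromList (≢-sym (≢₁₃ abt) ∷ ≢-sym (≢₂₃ abt) ∷ ≢-sym s≢t ∷ []))
      from : _△_ M (triple a b s) (triple a b t) ⊆ pair s t
      from h with ∈△⁻ h
      ... | inj₁ (h∈ , h∉) with ∈fromList⁻ h∈
      ...   | here refl = contradiction ∈₁ h∉
      ...   | there (here refl) = contradiction ∈₂ h∉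
      ...   | there (there (here refl)) = ∈₁
      from h | inj₂ (h∈ , h∉) with ∈fromList⁻ h∈
      ...   | here refl = contradiction ∈₁ h∉
      ...   | there (here refl) = contradiction ∈₂ h∉
      ...   | there (there (here refl)) = ∈₂
      st-circuit : Circuit M (pair s t)
      st-circuit = small-△⇒circuit (triangle⇒circuit abs) (triangle⇒circuit abt) (s , ∈₁) to from
        (≤-trans (∣fromList∣≤length (s ∷ t ∷ [])) (s≤s (s≤s z≤n)))

  triangles⇒4-circuit : ∀ {a b c d s} → Triangle a b s → Triangle c d s →
                        a ≢ c → a ≢ d → b ≢ c → b ≢ d → Circuit M (fromList (a ∷ b ∷ c ∷ d ∷ []))
  triangles⇒4-circuit {a} {b} {c} {d} {s} abs cds a≢c a≢d b≢c b≢d =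
    small-△⇒circuit (triangle⇒circuit abs) (triangle⇒circuit cds) (a , ∈₁) to from
      (≤-trans (∣fromList∣≤length (a ∷ b ∷ c ∷ d ∷ [])) (s≤s (s≤s (s≤s (s≤s z≤n)))))
    where
    to : fromList (a ∷ b ∷ c ∷ d ∷ []) ⊆ _△_ M (triple a b s) (triple c d s)
    to h with ∈fromList⁻ h
    ... | here refl = ∈△⁺ˡ ∈₁ (∉fromList (a≢c ∷ a≢d ∷ ≢₁₃ abs ∷ []))
    ... | there (here refl) = ∈△⁺ˡ ∈₂ (∉fromList (b≢c ∷ b≢d ∷ ≢₂₃ abs ∷ []))
    ... | there (there (here refl)) = ∈△⁺ʳ ∈₁ (∉fromList (≢-sym a≢c ∷ ≢-sym b≢c ∷ ≢₁₃ cds ∷ []))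
    ... | there (there (there (here refl))) = ∈△⁺ʳ ∈₂ (∉fromList (≢-sym a≢d ∷ ≢-sym b≢d ∷ ≢₂₃ cds ∷ []))
    from : _△_ M (triple a b s) (triple c d s) ⊆ fromList (a ∷ b ∷ c ∷ d ∷ [])
    from h with ∈△⁻ h
    ... | inj₁ (h∈ , h∉) with ∈fromList⁻ h∈
    ...   | here refl = ∈₁
    ...   | there (here refl) = ∈₂
    ...   | there (there (here refl)) = contradiction ∈₃ h∉
    from h | inj₂ (h∈ , h∉) with ∈fromList⁻ h∈
    ...   | here refl = ∈₃
    ...   | there (here refl) = ∈₄
    ...   | there (there (here refl)) = contradiction ∈₃ h∉

  4-circuit-△-triangle : ∀ {a b c d e} → Circuit M (fromList (a ∷ b ∷ c ∷ d ∷ [])) → Triangle b d e →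
                         a ≢ b → a ≢ d → c ≢ b → c ≢ d → e ≢ a → e ≢ c → Triangle a c e
  4-circuit-△-triangle {a} {b} {c} {d} {e} abcd bde a≢b a≢d c≢b c≢d e≢a e≢c =
    circuit⇒triangle (small-△⇒circuit abcd (triangle⇒circuit bde) (a , ∈₁) to from
      (≤-trans (∣fromList∣≤length (a ∷ c ∷ e ∷ [])) (s≤s (s≤s (s≤s z≤n)))))
    where
    to : triple a c e ⊆ _△_ M (fromList (a ∷ b ∷ c ∷ d ∷ [])) (triple b d e)
    to h with ∈fromList⁻ h
    ... | here refl = ∈△⁺ˡ ∈₁ (∉fromList (a≢b ∷ a≢d ∷ ≢-sym e≢a ∷ []))
    ... | there (here refl) = ∈△⁺ˡ ∈₃ (∉fromList (c≢b ∷ c≢d ∷ ≢-sym e≢c ∷ []))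
    ... | there (there (here refl)) =
      ∈△⁺ʳ ∈₃ (∉fromList (e≢a ∷ ≢-sym (≢₁₃ bde) ∷ e≢c ∷ ≢-sym (≢₂₃ bde) ∷ []))
    from : _△_ M (fromList (a ∷ b ∷ c ∷ d ∷ [])) (triple b d e) ⊆ triple a c e
    from h with ∈△⁻ h
    ... | inj₁ (h∈ , h∉) with ∈fromList⁻ h∈
    ...   | here refl = ∈₁
    ...   | there (here refl) = contradiction ∈₁ h∉
    ...   | there (there (here refl)) = ∈₂
    ...   | there (there (there (here refl))) = contradiction ∈₂ h∉
    from h | inj₂ (h∈ , h∉) with ∈fromList⁻ h∈
    ...   | here refl = contradiction ∈₂ h∉
    ...   | there (here refl) = contradiction ∈₄ h∉
    ...   | there (there (here refl)) = ∈₃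

  -- Over GF(2): x = s + b, y = s + d and e = b + d, so e = x + y.
  triangle-sum : ∀ {s x b y d e} → Triangle s x b → Triangle s y d → Triangle b d e → b ≢ d → Triangle x y e
  triangle-sum {s} {x} {b} {y} {d} {e} sxb syd bde b≢d with x Fin.≟ d
  ... | yes refl = swap₁₂ (subst (λ z → Triangle z x e) (third-point-unique sxb (swap₂₃ syd)) bde)
  ... | no x≢d = 4-circuit-△-triangle xbyd bde (≢₂₃ sxb) x≢d (≢-sym b≢y) (≢₂₃ syd) e≢x e≢y
    where
    x≢y : x ≢ y
    x≢y refl = b≢d (third-point-unique sxb syd)
    b≢y : b ≢ y
    b≢y refl = x≢d (third-point-unique (swap₂₃ sxb) syd)
    xbyd : Circuit M (fromList (x ∷ b ∷ y ∷ d ∷ []))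
    xbyd = triangles⇒4-circuit (swap₂₃ (swap₁₂ sxb)) (swap₂₃ (swap₁₂ syd)) x≢y x≢d b≢y b≢d
    e≢x : e ≢ x
    e≢x refl = ≢₁₃ syd (third-point-unique (swap₁₂ (rotate sxb)) (swap₂₃ bde))
    e≢y : e ≢ y
    e≢y refl = ≢₁₃ sxb (third-point-unique (swap₁₂ (rotate syd)) (rotate bde))

  modular-triangle-sum : ∀ {B s x u y v} → ModularFlat M B → x ∈ B → y ∈ B → x ≢ y → u ∉ B → v ∉ B →
                         Triangle s x u → Triangle s y v → ∃[ z ] z ∈ B × Triangle x y z
  modular-triangle-sum {B} {s} {x} {u} {y} {v} B-mod x∈B y∈B x≢y u∉B v∉B sxu syv =
    z , z∈B , triangle-sum sxu syv uvz u≢v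
    where
    u≢v : u ≢ v
    u≢v refl = x≢y (third-point-unique (swap₂₃ sxu) (swap₂₃ syv))
    K = cl M (B ∪ ⁅ u ⁆)
    B⊆K : B ⊆ K
    B⊆K = X⊆clX ∘ p⊆p∪q _
    u∈K : u ∈ K
    u∈K = X⊆clX (q⊆p∪q B _ (x∈⁅x⁆ u))
    s∈K : s ∈ K
    s∈K = triangle-closed (rotate sxu) (cl-flat _) (B⊆K x∈B) u∈K
    v∈K : v ∈ K
    v∈K = triangle-closed (swap₁₂ syv) (cl-flat _) (B⊆K y∈B) s∈K
    ℓ = cl M (pair u v)
    rkℓ≡2 : rk ℓ ≡ 2
    rkℓ≡2 = trans (rk-cl _) (rk-pair u≢v)
    B∪ℓ-small : rk (B ∪ ℓ) ≤ suc (rk B)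
    B∪ℓ-small = ≤-trans (rk-⊆ (∪⊆ B⊆K (cl-least (cl-flat _) (fromList⊆ (u∈K ∷ v∈K ∷ [])))))
                        (≤-trans (≤-reflexive (rk-cl _)) (rk-∪⁅⁆≤ B u))
    meet = modular-meets-line B-mod (cl-flat _) rkℓ≡2 B∪ℓ-small
    z = proj₁ meet
    z∈B = proj₁ (x∈p∩q⁻ B ℓ (proj₂ meet))
    uvz : Triangle u v z
    uvz = triangle-on-line u≢v (≢-sym (∈∉⇒≢ z∈B u∉B)) (≢-sym (∈∉⇒≢ z∈B v∉B))
            (X⊆clX ∈₁) (X⊆clX ∈₂) (proj₂ (x∈p∩q⁻ B ℓ (proj₂ meet))) rkℓ≡2

  module Cover {H T} (H-mod : ModularFlat M H) (T-flat : Flat M T) (H⊆T : H ⊆ T)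
               (T-covers-H : rk T ≤ suc (rk H)) where

    third-point-below : ∀ {u v} → u ∈ T ─ H → v ∈ T ─ H → u ≢ v → ∃[ w ] w ∈ H × Triangle u v w
    third-point-below {u} {v} u∈T─H v∈T─H u≢v =
      w , w∈H , triangle-on-line u≢v (≢-sym (∈∉⇒≢ w∈H u∉H)) (≢-sym (∈∉⇒≢ w∈H v∉H))
                                 (X⊆clX ∈₁) (X⊆clX ∈₂) w∈G rkG≡2
      where
      u∉H = proj₂ (x∈p─q⁻ T H u∈T─H)
      v∉H = proj₂ (x∈p─q⁻ T H v∈T─H)
      G = cl M (pair u v)
      rkG≡2 : rk G ≡ 2
      rkG≡2 = trans (rk-cl _) (rk-pair u≢v)
      G⊆T : G ⊆ T
      G⊆T = cl-least T-flat (fromList⊆ (proj₁ (x∈p─q⁻ T H u∈T─H) ∷ proj₁ (x∈p─q⁻ T H v∈T─H) ∷ []))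
      meet = modular-meets-line H-mod (cl-flat _) rkG≡2 (≤-trans (rk-⊆ (∪⊆ H⊆T G⊆T)) T-covers-H)
      w = proj₁ meet
      w∈H = proj₁ (x∈p∩q⁻ H G (proj₂ meet))
      w∈G = proj₂ (x∈p∩q⁻ H G (proj₂ meet))

    module Layer {A B X x y} (A-flat : Flat M A) (B-mod : ModularFlat M B) (A⊆B : A ⊆ B)
                 (x∈X : x ∈ X) (x∈A : x ∈ A) (y∈B─A : y ∈ B ─ A) where

      x≢y : x ≢ y
      x≢y = ∈∉⇒≢ x∈A (proj₂ (x∈p─q⁻ B A y∈B─A))

      -- Over GF(2): x = c₁ + c₂ = c₃ + c₄ and y = c₁ + c₃ = c₂ + c₄, so x + y = c₁ + c₄.
      linked-by-four-triangles : ∀ {c₁ c₂ c₃ c₄} → Triangle x c₁ c₂ → Triangle x c₃ c₄ →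
                                 Triangle y c₁ c₃ → Triangle y c₂ c₄ → TriangleBetween X (B ─ A)
      linked-by-four-triangles {c₁} {c₂} {c₃} {c₄} xc₁c₂ xc₃c₄ yc₁c₃ yc₂c₄ = choose (c₁ ∈? B) (c₄ ∈? B)
        where
        choose : Dec (c₁ ∈ B) → Dec (c₄ ∈ B) → TriangleBetween X (B ─ A)
        choose (yes c₁∈B) _ = triangle-to-layer A-flat (proj₁ B-mod) x∈X y∈B─A c₁∈B xc₁c₂ yc₁c₃ xc₃c₄
        choose (no _) (yes c₄∈B) =
          triangle-to-layer A-flat (proj₁ B-mod) x∈X y∈B─A c₄∈B (swap₂₃ xc₃c₄) (swap₂₃ yc₂c₄) (swap₂₃ xc₁c₂)
        choose (no c₁∉B) (no c₄∉B) =
          let z , _ , xyz = modular-triangle-sum B-mod (A⊆B x∈A) (proj₁ (x∈p─q⁻ B A y∈B─A)) x≢y c₁∉B c₄∉B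
                                                 (rotate (rotate xc₁c₂)) (swap₁₂ yc₂c₄)
          in _ , _ , z , x∈X , y∈B─A , xyz

      linked-via-common-point : ∀ {s b d} → Triangle s x b → Triangle s y d → b ∈ T ─ H → d ∈ T ─ H →
                         TriangleBetween X (B ─ A)
      linked-via-common-point sxb syd b∈ d∈ =
        let w , _ , bdw = third-point-below b∈ d∈ b≢d in _ , _ , w , x∈X , y∈B─A , triangle-sum sxb syd bdw b≢d
        where
        b≢d : _ ≢ _
        b≢d refl = x≢y (third-point-unique (swap₂₃ sxb) (swap₂₃ syd))

      linked-by-distinct-points : ∀ {p p′ q q′} → p ∈ T ─ H → p′ ∈ T ─ H → q ∈ T ─ H → q′ ∈ T ─ H →
                                  p ≢ q → p ≢ q′ → p′ ≢ q → p′ ≢ q′ →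
                                  Triangle x p p′ → Triangle y q q′ → TriangleBetween X (B ─ A)
      linked-by-distinct-points p∈ p′∈ q∈ q′∈ p≢q p≢q′ p′≢q p′≢q′ xpp′ yqq′ =
        let c₁ , _ , pqc₁   = third-point-below p∈ q∈ p≢q
            c₂ , _ , p′qc₂  = third-point-below p′∈ q∈ p′≢q
            c₃ , _ , pq′c₃  = third-point-below p∈ q′∈ p≢q′
            c₄ , _ , p′q′c₄ = third-point-below p′∈ q′∈ p′≢q′
        in linked-by-four-triangles
             (triangle-sum (swap₁₂ xpp′) (swap₂₃ pqc₁) p′qc₂ p′≢q)
             (triangle-sum (swap₁₂ xpp′) (swap₂₃ pq′c₃) p′q′c₄ p′≢q′)
             (triangle-sum (swap₁₂ yqq′) (rotate pqc₁) (swap₁₂ pq′c₃) (≢-sym p≢q′))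
             (triangle-sum (swap₁₂ yqq′) (rotate p′qc₂) (swap₁₂ p′q′c₄) (≢-sym p′≢q′))

      linked : ∀ {p p′ q q′} → p ∈ T ─ H → p′ ∈ T ─ H → q ∈ T ─ H → q′ ∈ T ─ H →
               Triangle x p p′ → Triangle y q q′ → TriangleBetween X (B ─ A)
      linked {p} {p′} {q} {q′} p∈ p′∈ q∈ q′∈ xpp′ yqq′
        with p Fin.≟ q | p Fin.≟ q′ | p′ Fin.≟ q | p′ Fin.≟ q′
      ... | yes refl | _ | _ | _ = linked-via-common-point (swap₁₂ xpp′) (swap₁₂ yqq′) p′∈ q′∈
      ... | no _ | yes refl | _ | _ = linked-via-common-point (swap₁₂ xpp′) (swap₁₂ (swap₂₃ yqq′)) p′∈ q∈
      ... | no _ | no _ | yes refl | _ = linked-via-common-point (swap₁₂ (swap₂₃ xpp′)) (swap₁₂ yqq′) p∈ q′∈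
      ... | no _ | no _ | no _ | yes refl =
        linked-via-common-point (swap₁₂ (swap₂₃ xpp′)) (swap₁₂ (swap₂₃ yqq′)) p∈ q∈
      ... | no p≢q | no p≢q′ | no p′≢q | no p′≢q′ =
        linked-by-distinct-points p∈ p′∈ q∈ q′∈ p≢q p≢q′ p′≢q p′≢q′ xpp′ yqq′

module SupersolvableChain {n : ℕ} (M : Matroid n) (simple : Simple M) (binary : Binary M) (ch : MChain M) where
  open Matroid M
  open MChain ch
  open RankFunction M
  open SimpleMatroid M simple
  open BinaryMatroid M simple binary

  P : Fin (rank M) → Subset n
  P = partition M ch

  F-flat : ∀ i → Flat M (F i)
  F-flat i = proj₁ (F-modular i)

  F-step : ∀ i → F (inject₁ i) ⊆ F (fsuc i)
  F-step i = proj₁ (F-strict i)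

  F-mono : ∀ {i j} → toℕ i ≤ toℕ j → F i ⊆ F j
  F-mono {i} = <-weakInduction-startingFrom (λ j → F i ⊆ F j) (λ h → h) (λ j F-i⊆ → F-step j ∘ F-i⊆)

  rk-F-step : ∀ i → rk (F (inject₁ i)) < rk (F (fsuc i))
  rk-F-step i with F-strict i
  ... | F-i⊆ , x , x∈ , x∉ = <-≤-trans (F-flat (inject₁ i) x x∉) (rk-⊆ (∪⊆ F-i⊆ (⁅x⁆⊆p x∈)))

  rk-F : ∀ i → rk (F i) ≡ toℕ i
  rk-F i = ≤-antisym (upper i) (lower i)
    where
    lower : ∀ i → toℕ i ≤ rk (F i)
    lower = <-weakInduction (λ i → toℕ i ≤ rk (F i)) z≤n λ i i≤rk →
      <-≤-trans (s≤s (subst (_≤ rk (F (inject₁ i))) (Fin.toℕ-inject₁ i) i≤rk)) (rk-F-step i)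
    upper : ∀ i → rk (F i) ≤ toℕ i
    upper = >-weakInduction (λ i → rk (F i) ≤ toℕ i)
      (≤-reflexive (trans (cong rk F-top) (sym (Fin.toℕ-fromℕ (rank M)))))
      λ i rk≤1+i → subst (rk (F (inject₁ i)) ≤_) (sym (Fin.toℕ-inject₁ i))
                          (≤-pred (<-≤-trans (rk-F-step i) rk≤1+i))

  F-covers : ∀ i → rk (F (fsuc i)) ≤ suc (rk (F (inject₁ i)))
  F-covers i = ≤-reflexive (begin
    rk (F (fsuc i))                ≡⟨ rk-F (fsuc i) ⟩
    suc (toℕ i)                    ≡⟨ cong suc (Fin.toℕ-inject₁ i) ⟨
    suc (toℕ (inject₁ i))          ≡⟨ cong suc (rk-F (inject₁ i)) ⟨
    suc (rk (F (inject₁ i)))       ∎)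
    where open ≡-Reasoning

  block⊆below : ∀ {a m} → toℕ a < toℕ m → P a ⊆ F (inject₁ m)
  block⊆below {a} {m} a<m = F-mono (subst (suc (toℕ a) ≤_) (sym (Fin.toℕ-inject₁ m)) a<m) ∘ p─q⊆p _ _

  adjacent-above⇒triangle : ∀ {a m} → toℕ a < toℕ m → SGraphAdj M P a m →
                            ∃[ x ] ∃[ p ] ∃[ p′ ] x ∈ P a × p ∈ P m × p′ ∈ P m × Triangle x p p′
  adjacent-above⇒triangle {a} {m} a<m (_ , L , L-line , (x , x∈L∩Pa) , (p , p∈L∩Pm)) =
    let x∈L , x∈Pa = x∈p∩q⁻ L (P a) x∈L∩Pa
        p∈L , p∈Pm = x∈p∩q⁻ L (P m) p∈L∩Pm
        p′ , p′∈Pm , xpp′ = line-third-point-outside (F-modular (inject₁ m)) (F-flat (fsuc m)) (F-step m) L-line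
                                      x∈L (block⊆below a<m x∈Pa) p∈L p∈Pm
    in x , p , p′ , x∈Pa , p∈Pm , p′∈Pm , xpp′

  lower-neighbours-linked : ∀ {a b m} → toℕ a < toℕ b → toℕ b < toℕ m →
                            SGraphAdj M P a m → SGraphAdj M P b m → TriangleBetween (P a) (P b)
  lower-neighbours-linked {a} {b} {m} a<b b<m a~m b~m =
    let x , p , p′ , x∈Pa , p∈ , p′∈ , xpp′ = adjacent-above⇒triangle (<-trans a<b b<m) a~m
        y , q , q′ , y∈Pb , q∈ , q′∈ , yqq′ = adjacent-above⇒triangle b<m b~m
    in Layer.linked (F-flat (inject₁ b)) (F-modular (fsuc b)) (F-step b) x∈Pa (block⊆below a<b x∈Pa) y∈Pb
                    p∈ p′∈ q∈ q′∈ xpp′ yqq′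
    where open Cover (F-modular (inject₁ m)) (F-flat (fsuc m)) (F-step m) (F-covers m)

  lower-neighbours-adjacent : ∀ {a b m} → toℕ a < toℕ m → toℕ b < toℕ m → a ≢ b →
                              SGraphAdj M P a m → SGraphAdj M P b m → SGraphAdj M P a b
  lower-neighbours-adjacent {a} {b} a<m b<m a≢b a~m b~m = a≢b , triangle⇒line (linked (<-cmp (toℕ a) (toℕ b)))
    where
    linked : _ → TriangleBetween (P a) (P b)
    linked (tri< a<b _ _) = lower-neighbours-linked a<b b<m a~m b~m
    linked (tri≈ _ a≡b _) = contradiction (Fin.toℕ-injective a≡b) a≢b
    linked (tri> _ _ b<a) = TriangleBetween-sym (lower-neighbours-linked b<a a<m b~m a~m)

argmax : ∀ {k} (f : Fin (suc k) → ℕ) → ∃[ i ] ∀ j → f j ≤ f i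
argmax {zero} f = fzero , λ { fzero → ≤-refl }
argmax {suc k} f with argmax (f ∘ fsuc)
... | i , f∘fsuc≤ with f fzero ≤? f (fsuc i)
...   | yes f0≤ = fsuc i , λ { fzero → f0≤ ; (fsuc j) → f∘fsuc≤ j }
...   | no f0≰ = fzero , λ { fzero → ≤-refl ; (fsuc j) → ≤-trans (f∘fsuc≤ j) (<⇒≤ (≰⇒> f0≰)) }

-- CycSucc k i j unfolds to CycSuccℕ k (toℕ i) (toℕ j).
CycSuccℕ : ℕ → ℕ → ℕ → Set
CycSuccℕ k a b = suc a ≡ b ⊎ (suc a ≡ k × b ≡ 0)

record CycleNeighbours (k : ℕ) (i : Fin k) : Set where
  field
    pred succ : Fin k
    pred→i    : CycSucc k pred i
    i→succ    : CycSucc k i succ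
    pred≢succ : pred ≢ succ
    pred↛succ : ¬ CycSucc k pred succ
    succ↛pred : ¬ CycSucc k succ pred

neighbours-at : ∀ {k t q′ s′} {i : Fin k} (q s : Fin k) → toℕ i ≡ t → toℕ q ≡ q′ → toℕ s ≡ s′ →
                CycSuccℕ k q′ t → CycSuccℕ k t s′ → q′ ≢ s′ →
                ¬ CycSuccℕ k q′ s′ → ¬ CycSuccℕ k s′ q′ → CycleNeighbours k i
neighbours-at q s refl refl refl q→i i→s q≢s q↛s s↛q = record
  { pred = q ; succ = s ; pred→i = q→i ; i→succ = i→s
  ; pred≢succ = q≢s ∘ cong toℕ ; pred↛succ = q↛s ; succ↛pred = s↛q }

-- The neighbours of position t are t − 1 and t + 1 modulo 4 + j.
cycle-neighbours : ∀ j (i : Fin (4 + j)) → CycleNeighbours (4 + j) i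
cycle-neighbours j i with toℕ i in i≡t
... | zero = neighbours-at (fromℕ< 3+j<) (fromℕ< 1<) i≡t (Fin.toℕ-fromℕ< 3+j<) (Fin.toℕ-fromℕ< 1<)
               (inj₂ (refl , refl)) (inj₁ refl) (λ ())
               (λ { (inj₁ ()) ; (inj₂ (_ , ())) }) (λ { (inj₁ ()) ; (inj₂ (() , _)) })
  where
  3+j< : 3 + j < 4 + j
  3+j< = n<1+n (3 + j)
  1< : 1 < 4 + j
  1< = s≤s (s≤s z≤n)
... | suc t with 2 + t ≟ 4 + j
...   | yes refl = neighbours-at (fromℕ< 2+j<) (fromℕ< 0<) i≡t (Fin.toℕ-fromℕ< 2+j<) (Fin.toℕ-fromℕ< 0<)
                     (inj₁ refl) (inj₂ (refl , refl)) (λ ())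
                     (λ { (inj₁ ()) ; (inj₂ (() , _)) }) (λ { (inj₁ ()) ; (inj₂ (() , _)) })
  where
  2+j< : 2 + j < 4 + j
  2+j< = <-trans (n<1+n (2 + j)) (n<1+n (3 + j))
  0< : 0 < 4 + j
  0< = s≤s z≤n
...   | no 2+t≢ = neighbours-at (fromℕ< t<) (fromℕ< 2+t<) i≡t (Fin.toℕ-fromℕ< t<) (Fin.toℕ-fromℕ< 2+t<)
                     (inj₁ refl) (inj₁ refl) (λ ())
                     (λ { (inj₁ ()) ; (inj₂ (_ , ())) }) (λ { (inj₁ ()) ; (inj₂ (() , refl)) })
  where
  1+t< : suc t < 4 + j
  1+t< = subst (_< 4 + j) i≡t (Fin.toℕ<n i)
  t< : t < 4 + j
  t< = <-trans (n<1+n t) 1+t<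
  2+t< : 2 + t < 4 + j
  2+t< = ≤∧≢⇒< 1+t< 2+t≢

module _ {r : ℕ} {Adj : Fin r → Fin r → Set} where

  chordal-by-elimination : (∀ {i j} → Adj i j → i ≢ j) → (∀ {i j} → Adj i j → Adj j i) →
                           (∀ {a b m} → toℕ a < toℕ m → toℕ b < toℕ m → a ≢ b → Adj a m → Adj b m → Adj a b) →
                           Chordal Adj
  chordal-by-elimination irreflexive symmetric lower-clique _ (s≤s (s≤s (s≤s (s≤s {n = j} _)))) c =
    pred , succ , pred≢succ , pred↛succ , succ↛pred ,
    lower-clique pred<top succ<top (pred≢succ ∘ v-inj pred succ) pred~top (symmetric top~succ)
    where
    open Cycle c
    top = proj₁ (argmax (toℕ ∘ v))
    open CycleNeighbours (cycle-neighbours j top)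
    pred~top = v-adj pred top pred→i
    top~succ = v-adj top succ i→succ
    pred<top : toℕ (v pred) < toℕ (v top)
    pred<top = ≤∧≢⇒< (proj₂ (argmax (toℕ ∘ v)) pred) (irreflexive pred~top ∘ Fin.toℕ-injective)
    succ<top : toℕ (v succ) < toℕ (v top)
    succ<top = ≤∧≢⇒< (proj₂ (argmax (toℕ ∘ v)) succ) (irreflexive top~succ ∘ sym ∘ Fin.toℕ-injective)

theorem2p10 : (n : ℕ) (M : Matroid n) → Simple M → Binary M →
    (ch : MChain M) → Chordal (SGraphAdj M (partition M ch))
theorem2p10 n M simple binary ch =
  chordal-by-elimination proj₁ (λ (i≢j , L , L-line , Li , Lj) → ≢-sym i≢j , L , L-line , Lj , Li)
    (SupersolvableChain.lower-neighbours-adjacent M simple binary ch)
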